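{- Suppose $0<1/n\ll\epsilon\ll d<1$ and $0\leq\nu<\epsilon$. Suppose that $G$ is a bipartite graph with vertex partition $(U,V)$ and $|V|=n$. Let $F$ be a star-forest with at most $n$ leaves and let $\psi:\mathrm{cen}(F)\to U$ be an injective map. Suppose the following hold: (A1) for each $u\in U$, $d_G(u)=(d\pm\epsilon)n$; (A2) for all $v\in V$, $\sum_{x\in V(F):\ \psi(x)\in N_G(v)}d_F(x)\geq \nu n$, and for all $v\in V$ except at most $\nu n$ vertices, $\sum_{x\in V(F):\ \psi(x)\in N_G(v)}d_F(x)=(d\pm\epsilon)n$; (A3) $\displaystyle\sum_{x,x':\ \psi(x)\psi(x')\in E(J_G(U,d,\epsilon))}d_F(x)d_F(x')\leq\epsilon n^2$. Then there exists an embedding $\phi$ of $F$ into $G$ which extends $\psi$.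
   Context: Hierarchy notation: the statement holds provided $\epsilon$ is sufficiently small in terms of $d$ and $n$ is sufficiently large in terms of $\epsilon$ (via non-decreasing threshold functions). $a=b\pm c$ means $b-c\leq a\leq b+c$. A star-forest is a forest all of whose components are stars; $\mathrm{cen}(F)$ is the set of centres of its star components (for a one-edge star one vertex is designated as centre). For $u,u'\in V(G)$, $d_G(u,u')=|N_G(u)\cap N_G(u')|$. The irregularity-graph $J_G(U,d,\epsilon)$ is the graph (possibly with loops) on vertex set $U$ in which $uu'$ ($u=u'$ allowed) is an edge iff $|d_G(u,u')-d^2|V||>3\epsilon|V|$. An embedding of $F$ into $G$ is an injective map $V(F)\to V(G)$ sending edges to edges; it extends $\psi$ if it agrees with $\psi$ on $\mathrm{cen}(F)$.
   Formalization: The constants $d$, $\epsilon$ and $\nu$ range over the rationals. -}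

module Defs where

open import Data.Nat as ℕ using (ℕ; zero; suc)
open import Data.Fin using (Fin; zero; suc)
open import Data.Bool using (Bool; true; false; if_then_else_; not)
open import Data.Sum using (_⊎_; inj₁; inj₂)
open import Data.Product using (Σ; Σ-syntax; _,_; ∃; _×_)
open import Data.Integer using (+_)
open import Data.Rational as ℚ using (ℚ; _/_)
open import Relation.Binary.PropositionalEquality using (_≡_)
open import Relation.Nullary using (¬_)
open import Function.Definitions using (Injective)
import Data.Rational.Properties as ℚP
open import Relation.Nullary.Decidable using (⌊_⌋; Dec; _×-dec_)

ℕtoℚ : ℕ → ℚ
ℕtoℚ n = + n / 1

infix 4 _≈_±_
_≈_±_ : ℚ → ℚ → ℚ → Set
a ≈ b ± c = (b ℚ.- c ℚ.≤ a) × (a ℚ.≤ b ℚ.+ c)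

sumFin : (k : ℕ) → (Fin k → ℕ) → ℕ
sumFin zero f = 0
sumFin (suc k) f = f zero ℕ.+ sumFin k (λ i → f (suc i))

countFin : (k : ℕ) → (Fin k → Bool) → ℕ
countFin k P = sumFin k (λ i → if P i then 1 else 0)

-- Bipartite graphs with parts U = Fin m, V = Fin n.
-- adj u v = true iff uv ∈ E(G).

BipGraph : ℕ → ℕ → Set
BipGraph m n = Fin m → Fin n → Bool

VG : ℕ → ℕ → Set
VG m n = Fin m ⊎ Fin n

EdgeG : ∀ {m n} → BipGraph m n → VG m n → VG m n → Set
EdgeG G (inj₁ u) (inj₂ v) = G u v ≡ true
EdgeG G (inj₂ v) (inj₁ u) = G u v ≡ true
EdgeG G (inj₁ _) (inj₁ _) = Data.Empty.⊥ where import Data.Empty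
EdgeG G (inj₂ _) (inj₂ _) = Data.Empty.⊥ where import Data.Empty

degU : ∀ {m n} → BipGraph m n → Fin m → ℕ
degU {n = n} G u = countFin n (G u)

codeg : ∀ {m n} → BipGraph m n → Fin m → Fin m → ℕ
codeg {n = n} G u u' = countFin n (λ v → G u v Data.Bool.∧ G u' v)
  where import Data.Bool

-- uu' ∈ E(J_G(U,d,ε))  (u = u' allowed):  |d_G(u,u') - d²|V|| > 3ε|V|
JEdge : ∀ {m n} → BipGraph m n → ℚ → ℚ → Fin m → Fin m → Set
JEdge {n = n} G d ε u u' =
  (+ 3 / 1) ℚ.* ε ℚ.* ℕtoℚ n ℚ.< ℚ.∣ ℕtoℚ (codeg G u u') ℚ.- d ℚ.* d ℚ.* ℕtoℚ n ∣

jedge? : ∀ {m n} → BipGraph m n → ℚ → ℚ → Fin m → Fin m → Bool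
jedge? {n = n} G d ε u u' =
  ⌊ (+ 3 / 1) ℚ.* ε ℚ.* ℕtoℚ n ℚP.<? ℚ.∣ ℕtoℚ (codeg G u u') ℚ.- d ℚ.* d ℚ.* ℕtoℚ n ∣ ⌋

-- Star-forests.  A star-forest with k components is given by the number
-- of leaves ℓ i of the i-th star; the centre of star i is the vertex
-- inj₁ i, its leaves are inj₂ (i , j) for j < ℓ i.

record StarForest : Set where
  field
    k : ℕ
    ℓ : Fin k → ℕ

open StarForest public

Cen : StarForest → Set
Cen F = Fin (k F)

Leaf : StarForest → Set
Leaf F = Σ (Fin (k F)) (λ i → Fin (ℓ F i))

VF : StarForest → Set
VF F = Cen F ⊎ Leaf F

EdgeF : (F : StarForest) → VF F → VF F → Set
EdgeF F (inj₁ i) (inj₂ (i' , _)) = i ≡ i'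
EdgeF F (inj₂ (i' , _)) (inj₁ i) = i ≡ i'
EdgeF F (inj₁ _) (inj₁ _) = Data.Empty.⊥ where import Data.Empty
EdgeF F (inj₂ _) (inj₂ _) = Data.Empty.⊥ where import Data.Empty

numLeaves : StarForest → ℕ
numLeaves F = sumFin (k F) (ℓ F)

degCen : (F : StarForest) → Cen F → ℕ
degCen F i = ℓ F i

-- Σ_{x ∈ V(F) : ψ(x) ∈ N_G(v)} d_F(x)   (ψ is defined on centres only)
weightAt : ∀ {m n} → BipGraph m n → (F : StarForest) → (Cen F → Fin m) → Fin n → ℕ
weightAt G F ψ v = sumFin (k F) (λ i → if G (ψ i) v then ℓ F i else 0)

IsEmbeddingExtending : ∀ {m n} → (G : BipGraph m n) → (F : StarForest) →
  (Cen F → Fin m) → (VF F → VG m n) → Set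
IsEmbeddingExtending G F ψ φ =
  Injective _≡_ _≡_ φ
  × (∀ x y → EdgeF F x y → EdgeG G (φ x) (φ y))
  × (∀ i → φ (inj₁ i) ≡ inj₁ (ψ i))

-- Σ_{x,x' ∈ cen(F) : ψ(x)ψ(x') ∈ E(J_G(U,d,ε))} d_F(x) d_F(x')   (ordered pairs, x = x' allowed)
irregularWeight : ∀ {m n} → BipGraph m n → ℚ → ℚ → (F : StarForest) → (Cen F → Fin m) → ℕ
irregularWeight G d ε F ψ =
  sumFin (k F) (λ i → sumFin (k F) (λ i' →
    if jedge? G d ε (ψ i) (ψ i') then ℓ F i ℕ.* ℓ F i' else 0))

_≈?_±_ : (a b c : ℚ) → Dec (a ≈ b ± c)
a ≈? b ± c = _×-dec_ ((b ℚ.- c) ℚP.≤? a) (a ℚP.≤? (b ℚ.+ c))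

badCount : ∀ {m n} → BipGraph m n → ℚ → ℚ → (F : StarForest) → (Cen F → Fin m) → ℕ
badCount {n = n} G d ε F ψ = countFin n (λ v →
  not ⌊ _≈?_±_ (ℕtoℚ (weightAt G F ψ v)) (d ℚ.* ℕtoℚ n) (ε ℚ.* ℕtoℚ n) ⌋)

module Submission where

-- Since ψ is injective, embedding F means choosing for every centre x a set of d_F(x) vertices
-- of N_G(ψ(x)), disjointly: a matching with demands d_F.  By Hall's theorem it exists once every
-- set S of centres has Σ_{x∈S} d_F(x) ≤ |N(ψ(S))|.
--
-- Suppose S violates this; let w = Σ_{x∈S} d_F(x), a(v) = Σ_{x∈S, ψ(x)∈N(v)} d_F(x) and W < w
-- the number of v with a(v) > 0.  A vertex v with a(v) = 0 sees no centre of S, so w plus its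
-- weight Σ_{ψ(x)∈N(v)} d_F(x) is at most n.  If all these n - W vertices are exceptional in (A2),
-- there are at most νn of them and each has weight ≥ νn, so w + (n - W) ≤ n.  Otherwise one of
-- them has weight ≥ (d-ε)n, so w ≤ (1-d+ε)n.  Then (A1) gives Σ_v a(v) ≥ (d-ε)nw, (A3) and the
-- definition of J give Σ_v a(v)² ≤ n((d²+3ε)w² + εn²), and Cauchy–Schwarz over the W < w
-- vertices of positive load yields (d-ε)³ ≤ (d-ε)(d²+3ε)(1-d+ε) + ε, which fails for small ε.

module FiniteSums where

  open import Defs
  open import Algebra.Bundles using (CommutativeMonoid)
  open import Data.Bool.Base using (Bool; true; false; if_then_else_; not; _∧_; _∨_)
  open import Data.Bool.Properties using (∨-commutativeMonoid; ∧-distribʳ-∨; ∧-zeroʳ; ∧-identityʳ)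
  open import Data.Fin.Base using (Fin; zero; suc)
  open import Data.Fin.Properties using (_≟_; any?)
  open import Data.Fin.Subset.Properties using (anySubset?)
  open import Data.Nat.Base using (ℕ; zero; suc; _+_; _*_; _≤_; _<_; z≤n)
  open import Data.Nat.Properties hiding (_≟_)
  open import Data.Product.Base using (∃; _,_)
  open import Data.Vec.Base using (lookup; tabulate)
  open import Data.Vec.Properties using (lookup∘tabulate)
  open import Relation.Binary.PropositionalEquality
  open import Relation.Nullary.Decidable.Core using (Dec; yes; no; does; map′)
  open import Relation.Nullary.Negation using (contradiction)
  open import Algebra.Properties.CommutativeSemigroup +-commutativeSemigroup using (interchange; x∙yz≈y∙xz)
  open import Algebra.Properties.CommutativeSemigroup (CommutativeMonoid.commutativeSemigroup ∨-commutativeMonoid)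
    using () renaming (interchange to ∨-interchange)

  ind : Bool → ℕ
  ind b = if b then 1 else 0

  sumFin-cong : ∀ k {f g : Fin k → ℕ} → (∀ i → f i ≡ g i) → sumFin k f ≡ sumFin k g
  sumFin-cong zero    f≗g = refl
  sumFin-cong (suc k) f≗g = cong₂ _+_ (f≗g zero) (sumFin-cong k (λ i → f≗g (suc i)))

  sumFin-mono-≤ : ∀ k {f g : Fin k → ℕ} → (∀ i → f i ≤ g i) → sumFin k f ≤ sumFin k g
  sumFin-mono-≤ zero    f≤g = z≤n
  sumFin-mono-≤ (suc k) f≤g = +-mono-≤ (f≤g zero) (sumFin-mono-≤ k (λ i → f≤g (suc i)))

  sumFin-distrib-+ : ∀ k (f g : Fin k → ℕ) →
                     sumFin k (λ i → f i + g i) ≡ sumFin k f + sumFin k g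
  sumFin-distrib-+ zero    f g = refl
  sumFin-distrib-+ (suc k) f g
    rewrite sumFin-distrib-+ k (λ i → f (suc i)) (λ i → g (suc i)) = interchange (f zero) (g zero) _ _

  *-distribˡ-sumFin : ∀ k c (f : Fin k → ℕ) → c * sumFin k f ≡ sumFin k (λ i → c * f i)
  *-distribˡ-sumFin zero    c f = *-zeroʳ c
  *-distribˡ-sumFin (suc k) c f =
    trans (*-distribˡ-+ c (f zero) _) (cong (c * f zero +_) (*-distribˡ-sumFin k c (λ i → f (suc i))))

  *-distribʳ-sumFin : ∀ k c (f : Fin k → ℕ) → sumFin k f * c ≡ sumFin k (λ i → f i * c)
  *-distribʳ-sumFin k c f =
    trans (*-comm (sumFin k f) c) (trans (*-distribˡ-sumFin k c f) (sumFin-cong k (λ i → *-comm c (f i))))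

  sumFin-square : ∀ k (c : Fin k → ℕ) → sumFin k c * sumFin k c ≡ sumFin k (λ i → sumFin k (λ i' → c i * c i'))
  sumFin-square k c = trans (*-distribʳ-sumFin k (sumFin k c) c) (sumFin-cong k (λ i → *-distribˡ-sumFin k (c i) c))

  sumFin-zero : ∀ k → sumFin k (λ _ → 0) ≡ 0
  sumFin-zero zero    = refl
  sumFin-zero (suc k) = sumFin-zero k

  sumFin-comm : ∀ a b (f : Fin a → Fin b → ℕ) →
                sumFin a (λ i → sumFin b (f i)) ≡ sumFin b (λ j → sumFin a (λ i → f i j))
  sumFin-comm zero    b f = sym (sumFin-zero b)
  sumFin-comm (suc a) b f rewrite sumFin-comm a b (λ i → f (suc i)) =
    sym (sumFin-distrib-+ b (f zero) (λ j → sumFin a (λ i → f (suc i) j)))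

  term≤sumFin : ∀ k (f : Fin k → ℕ) i → f i ≤ sumFin k f
  term≤sumFin (suc k) f zero    = m≤m+n (f zero) _
  term≤sumFin (suc k) f (suc i) = ≤-trans (term≤sumFin k (λ j → f (suc j)) i) (m≤n+m _ (f zero))

  sumFin≡0⇒term≡0 : ∀ k (f : Fin k → ℕ) → sumFin k f ≡ 0 → ∀ i → f i ≡ 0
  sumFin≡0⇒term≡0 k f Σf≡0 i = n≤0⇒n≡0 (subst (f i ≤_) Σf≡0 (term≤sumFin k f i))

  sumFin-positive : ∀ k (f : Fin k → ℕ) → 0 < sumFin k f → ∃ λ i → 0 < f i
  sumFin-positive k f Σf>0 with any? (λ i → 0 <? f i)
  ... | yes found = found
  ... | no  none  = contradiction (trans (sumFin-cong k f≡0) (sumFin-zero k)) (>⇒≢ Σf>0)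
    where
    f≡0 : ∀ i → f i ≡ 0
    f≡0 i = n≤0⇒n≡0 (≮⇒≥ λ 0<fi → none (i , 0<fi))

  sumFin-remove : ∀ k (f : Fin k → ℕ) x →
                  sumFin k f ≡ f x + sumFin k (λ i → if does (i ≟ x) then 0 else f i)
  sumFin-remove (suc k) f zero    = refl
  sumFin-remove (suc k) f (suc x) rewrite sumFin-remove k (λ i → f (suc i)) x =
    x∙yz≈y∙xz (f zero) (f (suc x)) _

  if-then-0≡*ind : ∀ b c → (if b then c else 0) ≡ c * ind b
  if-then-0≡*ind true  c = sym (*-identityʳ c)
  if-then-0≡*ind false c = sym (*-zeroʳ c)

  ind≤1 : ∀ b → ind b ≤ 1
  ind≤1 true  = ≤-refl
  ind≤1 false = z≤n

  countFin≤ : ∀ k (P : Fin k → Bool) → countFin k P ≤ k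
  countFin≤ zero    P = z≤n
  countFin≤ (suc k) P = +-mono-≤ (ind≤1 (P zero)) (countFin≤ k (λ i → P (suc i)))

  countFin-mono : ∀ k (P Q : Fin k → Bool) → (∀ i → P i ≡ true → Q i ≡ true) →
                  countFin k P ≤ countFin k Q
  countFin-mono k P Q P⇒Q = sumFin-mono-≤ k ind-mono
    where
    ind-mono : ∀ i → ind (P i) ≤ ind (Q i)
    ind-mono i with P i in Pi
    ... | false = z≤n
    ... | true  rewrite P⇒Q i Pi = ≤-refl

  countFin-positive : ∀ k (P : Fin k → Bool) → 0 < countFin k P → ∃ λ i → P i ≡ true
  countFin-positive k P count>0 with sumFin-positive k (λ i → ind (P i)) count>0
  ... | i , ind>0 with P i in Pi
  ...   | true = i , Pi

  countFin-not+countFin : ∀ k (P : Fin k → Bool) → countFin k (λ i → not (P i)) + countFin k P ≡ k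
  countFin-not+countFin zero    P = refl
  countFin-not+countFin (suc k) P with P zero
  ... | true  = trans (+-suc _ _) (cong suc (countFin-not+countFin k (λ i → P (suc i))))
  ... | false = cong suc (countFin-not+countFin k (λ i → P (suc i)))

  countFin-remove : ∀ k (P : Fin k → Bool) y →
                    countFin k P ≡ ind (P y) + countFin k (λ v → P v ∧ not (does (v ≟ y)))
  countFin-remove k P y =
    trans (sumFin-remove k (λ v → ind (P v)) y) (cong (ind (P y) +_) (sumFin-cong k drop-y))
    where
    drop-y : ∀ v → (if does (v ≟ y) then 0 else ind (P v)) ≡ ind (P v ∧ not (does (v ≟ y)))
    drop-y v with does (v ≟ y)
    ... | true  = cong ind (sym (∧-zeroʳ (P v)))
    ... | false = cong ind (sym (∧-identityʳ (P v)))

  anyFin : ∀ k → (Fin k → Bool) → Bool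
  anyFin zero    f = false
  anyFin (suc k) f = f zero ∨ anyFin k (λ i → f (suc i))

  anyFin-intro : ∀ k (f : Fin k → Bool) i → f i ≡ true → anyFin k f ≡ true
  anyFin-intro (suc k) f zero    fi rewrite fi = refl
  anyFin-intro (suc k) f (suc i) fi with f zero
  ... | true  = refl
  ... | false = anyFin-intro k (λ j → f (suc j)) i fi

  anyFin-elim : ∀ k (f : Fin k → Bool) → anyFin k f ≡ true → ∃ λ i → f i ≡ true
  anyFin-elim (suc k) f any with f zero in f0
  ... | true  = zero , f0
  ... | false with anyFin-elim k (λ j → f (suc j)) any
  ...   | i , fi = suc i , fi

  anyFin-cong : ∀ k {f g : Fin k → Bool} → (∀ i → f i ≡ g i) → anyFin k f ≡ anyFin k g
  anyFin-cong zero    f≗g = refl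
  anyFin-cong (suc k) f≗g = cong₂ _∨_ (f≗g zero) (anyFin-cong k (λ i → f≗g (suc i)))

  anyFin-∨ : ∀ k (f g : Fin k → Bool) → anyFin k (λ i → f i ∨ g i) ≡ anyFin k f ∨ anyFin k g
  anyFin-∨ zero    f g = refl
  anyFin-∨ (suc k) f g rewrite anyFin-∨ k (λ i → f (suc i)) (λ i → g (suc i)) =
    ∨-interchange (f zero) (g zero) _ _

  anyFin-∧ʳ : ∀ k (f : Fin k → Bool) b → anyFin k (λ i → f i ∧ b) ≡ anyFin k f ∧ b
  anyFin-∧ʳ zero    f b = refl
  anyFin-∧ʳ (suc k) f b rewrite anyFin-∧ʳ k (λ i → f (suc i)) b = sym (∧-distribʳ-∨ b (f zero) _)

  -- Subsets are functions, which are only equal pointwise; hence P must respect ≗.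
  any-subset? : ∀ {k} {P : (Fin k → Bool) → Set} →
                (∀ {S S'} → (∀ i → S i ≡ S' i) → P S → P S') → (∀ S → Dec (P S)) → Dec (∃ P)
  any-subset? resp P? =
    map′ (λ (s , Ps) → lookup s , Ps)
         (λ (S , PS) → tabulate S , resp (λ i → sym (lookup∘tabulate S i)) PS)
         (anySubset? (λ s → P? (lookup s)))

module CauchySchwarz where

  open import Defs
  open FiniteSums
  open import Data.Bool.Base using (true; not)
  open import Data.Fin.Base using (Fin; zero; suc)
  open import Data.Nat.Base using (ℕ; zero; suc; _+_; _*_; _≤_; _<_; _<ᵇ_; z≤n; s≤s)
  open import Data.Nat.Properties hiding (_≟_)
  open import Data.Nat.Tactic.RingSolver using (solve-∀)
  open import Data.Product.Base using (_,_)
  open import Data.Sum.Base using ([_,_]′)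
  open import Relation.Binary.PropositionalEquality

  0<ᵇ⇒0< : ∀ {x} → (0 <ᵇ x) ≡ true → 0 < x
  0<ᵇ⇒0< {suc _} _ = s≤s z≤n

  0<⇒0<ᵇ : ∀ {x} → 0 < x → (0 <ᵇ x) ≡ true
  0<⇒0<ᵇ {suc _} _ = refl

  ¬0<ᵇ⇒≡0 : ∀ {x} → not (0 <ᵇ x) ≡ true → x ≡ 0
  ¬0<ᵇ⇒≡0 {zero} _ = refl

  support : ∀ k → (Fin k → ℕ) → ℕ
  support k f = countFin k (λ i → 0 <ᵇ f i)

  2xy≤x²+y² : ∀ x y → x * y + x * y ≤ x * x + y * y
  2xy≤x²+y² x y = [ ordered , swapped ]′ (≤-total x y)
    where
    ordered : ∀ {x y} → x ≤ y → x * y + x * y ≤ x * x + y * y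
    ordered {x} x≤y with m≤n⇒∃[o]m+o≡n x≤y
    ... | t , refl = subst (x * (x + t) + x * (x + t) ≤_) (square-gap x t) (m≤m+n _ (t * t))
      where
      square-gap : ∀ x t → x * (x + t) + x * (x + t) + t * t ≡ x * x + (x + t) * (x + t)
      square-gap = solve-∀
    swapped : y ≤ x → x * y + x * y ≤ x * x + y * y
    swapped y≤x = subst₂ _≤_ (cong₂ _+_ (*-comm y x) (*-comm y x)) (+-comm (y * y) (x * x)) (ordered y≤x)

  2xy≤x²+[x>0]y² : ∀ x y → x * y + x * y ≤ x * x + ind (0 <ᵇ x) * (y * y)
  2xy≤x²+[x>0]y² zero    y = z≤n
  2xy≤x²+[x>0]y² (suc x) y =
    subst (suc x * y + suc x * y ≤_) (cong (suc x * suc x +_) (sym (+-identityʳ (y * y)))) (2xy≤x²+y² (suc x) y)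

  2xΣf≤Σf²+support·x² : ∀ k (f : Fin k → ℕ) x →
                        sumFin k f * x + sumFin k f * x ≤ sumFin k (λ i → f i * f i) + support k f * (x * x)
  2xΣf≤Σf²+support·x² k f x = begin
    sumFin k f * x + sumFin k f * x
      ≡⟨ cong₂ _+_ (*-distribʳ-sumFin k x f) (*-distribʳ-sumFin k x f) ⟩
    sumFin k (λ i → f i * x) + sumFin k (λ i → f i * x)
      ≡⟨ sumFin-distrib-+ k _ _ ⟨
    sumFin k (λ i → f i * x + f i * x)
      ≤⟨ sumFin-mono-≤ k (λ i → 2xy≤x²+[x>0]y² (f i) x) ⟩
    sumFin k (λ i → f i * f i + ind (0 <ᵇ f i) * (x * x))
      ≡⟨ sumFin-distrib-+ k _ _ ⟩
    sumFin k (λ i → f i * f i) + sumFin k (λ i → ind (0 <ᵇ f i) * (x * x))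
      ≡⟨ cong (sumFin k (λ i → f i * f i) +_) (*-distribʳ-sumFin k (x * x) _) ⟨
    sumFin k (λ i → f i * f i) + support k f * (x * x) ∎
    where open ≤-Reasoning

  cauchy-schwarz : ∀ k (f : Fin k → ℕ) → sumFin k f * sumFin k f ≤ support k f * sumFin k (λ i → f i * f i)
  cauchy-schwarz zero    f = z≤n
  cauchy-schwarz (suc k) f with f zero
  ... | zero  = cauchy-schwarz k (λ i → f (suc i))
  ... | suc x = begin
    (y + s) * (y + s)                 ≡⟨ expand y s ⟩
    y * y + (s * y + s * y) + s * s   ≤⟨ +-mono-≤ (+-monoʳ-≤ (y * y) (2xΣf≤Σf²+support·x² k rest y))
                                                  (cauchy-schwarz k rest) ⟩
    y * y + (q + c * (y * y)) + c * q ≡⟨ collect y q c ⟩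
    (1 + c) * (y * y + q)             ∎
    where
    open ≤-Reasoning
    y = suc x
    rest = λ i → f (suc i)
    s = sumFin k rest
    q = sumFin k (λ i → rest i * rest i)
    c = support k rest
    expand : ∀ y s → (y + s) * (y + s) ≡ y * y + (s * y + s * y) + s * s
    expand = solve-∀
    collect : ∀ y q c → y * y + (q + c * (y * y)) + c * q ≡ (1 + c) * (y * y + q)
    collect = solve-∀

module HallTheorem where

  open import Defs
  open FiniteSums
  open import Data.Bool.Base using (Bool; true; false; if_then_else_; not; _∧_; _∨_)
  open import Data.Bool.Properties using (∧-assoc; ∧-conicalˡ; ∧-conicalʳ; ∧-distribʳ-∨; if-∧)
    renaming (_≟_ to _≟ᵇ_)
  open import Data.Fin.Base using (Fin; zero; suc)
  open import Data.Fin.Properties using (_≟_; any?)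
  open import Data.Nat.Base using (ℕ; zero; suc; _+_; _≤_; _<_; z≤n; s≤s⁻¹; pred; >-nonZero)
  open import Data.Nat.Properties hiding (_≟_)
  import Data.Nat.Properties as ℕ
  open import Data.Product.Base using (∃; _×_; _,_)
  open import Data.Sum.Base using (_⊎_; inj₁; inj₂; [_,_]′)
  open import Data.Vec.Functional using (updateAt)
  open import Data.Vec.Functional.Properties using (updateAt-updates; updateAt-minimal)
  open import Relation.Binary.PropositionalEquality
  open import Relation.Nullary.Decidable using (dec-true)
  open import Relation.Nullary.Decidable.Core using (Dec; yes; no; does; _×-dec_)
  open import Relation.Nullary.Negation using (¬_; contradiction)

  module _ {a : ℕ} where

    _↾_ : (Fin a → ℕ) → (Fin a → Bool) → Fin a → ℕ
    (ℓ ↾ S) i = if S i then ℓ i else 0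

    ↾≤ : ∀ ℓ S i → (ℓ ↾ S) i ≤ ℓ i
    ↾≤ ℓ S i with S i
    ... | true  = ≤-refl
    ... | false = z≤n

    weight : (Fin a → ℕ) → (Fin a → Bool) → ℕ
    weight ℓ S = sumFin a (ℓ ↾ S)

    weight-cong : ∀ ℓ {S S'} → (∀ i → S i ≡ S' i) → weight ℓ S ≡ weight ℓ S'
    weight-cong ℓ S≗S' = sumFin-cong a (λ i → cong (if_then ℓ i else 0) (S≗S' i))

  module _ {a n : ℕ} where

    neighbour : BipGraph a n → (Fin a → Bool) → Fin n → Bool
    neighbour H S v = anyFin a (λ i → S i ∧ H i v)

    ∣N∣ : BipGraph a n → (Fin a → Bool) → ℕ
    ∣N∣ H S = countFin n (neighbour H S)

    HallCondition : BipGraph a n → (Fin a → ℕ) → Set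
    HallCondition H ℓ = ∀ S → weight ℓ S ≤ ∣N∣ H S

    -- ℓ i is the demand of i; partner i j p serves its j-th unit.
    record Matching (H : BipGraph a n) (ℓ : Fin a → ℕ) : Set where
      field
        partner           : ∀ i j → j < ℓ i → Fin n
        partner-adjacent  : ∀ i j p → H i (partner i j p) ≡ true
        partner-injective : ∀ {i j i' j'} p p' → partner i j p ≡ partner i' j' p' → i ≡ i' × j ≡ j'

    open Matching

    restrict : BipGraph a n → (Fin n → Bool) → BipGraph a n
    restrict H keep i v = H i v ∧ keep v

    neighbour-intro : ∀ H S i v → S i ≡ true → H i v ≡ true → neighbour H S v ≡ true
    neighbour-intro H S i v Si Hiv = anyFin-intro a _ i (cong₂ _∧_ Si Hiv)

    neighbour-restrict : ∀ H keep S v → neighbour (restrict H keep) S v ≡ neighbour H S v ∧ keep v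
    neighbour-restrict H keep S v =
      trans (anyFin-cong a (λ i → sym (∧-assoc (S i) (H i v) (keep v)))) (anyFin-∧ʳ a _ (keep v))

    neighbour-∨ : ∀ H S S' v → neighbour H (λ i → S i ∨ S' i) v ≡ neighbour H S v ∨ neighbour H S' v
    neighbour-∨ H S S' v =
      trans (anyFin-cong a (λ i → ∧-distribʳ-∨ (H i v) (S i) (S' i))) (anyFin-∨ a _ _)

    ∣N∣-cong : ∀ H {S S'} → (∀ i → S i ≡ S' i) → ∣N∣ H S ≡ ∣N∣ H S'
    ∣N∣-cong H S≗S' = sumFin-cong n (λ v → cong ind (anyFin-cong a (λ i → cong (_∧ H i v) (S≗S' i))))

    ∣N∣-mono : ∀ H {S S'} → (∀ i → S i ≡ true → S' i ≡ true) → ∣N∣ H S ≤ ∣N∣ H S'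
    ∣N∣-mono H {S} {S'} S⊆S' = countFin-mono n _ _ N⊆N'
      where
      N⊆N' : ∀ v → neighbour H S v ≡ true → neighbour H S' v ≡ true
      N⊆N' v v∈N with anyFin-elim a _ v∈N
      ... | i , SiHiv = neighbour-intro H S' i v (S⊆S' i (∧-conicalˡ _ _ SiHiv)) (∧-conicalʳ _ _ SiHiv)

    no-demand : ∀ H ℓ → (∀ i → ¬ 0 < ℓ i) → Matching H ℓ
    no-demand H ℓ ℓ≯0 = record
      { partner           = λ i j p → contradiction (≤-<-trans z≤n p) (ℓ≯0 i)
      ; partner-adjacent  = λ i j p → contradiction (≤-<-trans z≤n p) (ℓ≯0 i)
      ; partner-injective = λ {i} p p' _ → contradiction (≤-<-trans z≤n p) (ℓ≯0 i)
      }

    module Tight (H : BipGraph a n) (ℓ : Fin a → ℕ) (S : Fin a → Bool) where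

      ℓ-in ℓ-out : Fin a → ℕ
      ℓ-in    = ℓ ↾ S
      ℓ-out i = if S i then 0 else ℓ i

      H-out : BipGraph a n
      H-out = restrict H (λ v → not (neighbour H S v))

      sumFin-split : sumFin a ℓ ≡ weight ℓ S + sumFin a ℓ-out
      sumFin-split = trans (sumFin-cong a split) (sumFin-distrib-+ a ℓ-in ℓ-out)
        where
        split : ∀ i → ℓ i ≡ ℓ-in i + ℓ-out i
        split i with S i
        ... | true  = sym (+-identityʳ (ℓ i))
        ... | false = refl

      hall-in : HallCondition H ℓ → HallCondition H ℓ-in
      hall-in hall S' = begin
        weight ℓ-in S'                  ≡⟨ sumFin-cong a (λ i → if-∧ (S' i)) ⟨
        weight ℓ (λ i → S' i ∧ S i)     ≤⟨ hall _ ⟩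
        ∣N∣ H (λ i → S' i ∧ S i)        ≤⟨ ∣N∣-mono H (λ i → ∧-conicalˡ (S' i) (S i)) ⟩
        ∣N∣ H S'                        ∎
        where open ≤-Reasoning

      hall-out : HallCondition H ℓ → ∣N∣ H S ≤ weight ℓ S → HallCondition H-out ℓ-out
      hall-out hall tight S' = +-cancelʳ-≤ (weight ℓ S) _ _ (begin
        weight ℓ-out S' + weight ℓ S                 ≡⟨ trans (sym (sumFin-distrib-+ a _ _)) (sumFin-cong a union) ⟩
        weight ℓ (λ i → S' i ∨ S i)                  ≤⟨ hall _ ⟩
        ∣N∣ H (λ i → S' i ∨ S i)                     ≤⟨ sumFin-mono-≤ n cover ⟩
        sumFin n (λ v → ind (neighbour H-out S' v) + ind (neighbour H S v))
                                                     ≡⟨ sumFin-distrib-+ n _ _ ⟩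
        ∣N∣ H-out S' + ∣N∣ H S                        ≤⟨ +-monoʳ-≤ (∣N∣ H-out S') tight ⟩
        ∣N∣ H-out S' + weight ℓ S                     ∎)
        where
        open ≤-Reasoning
        union : ∀ i → (if S' i then ℓ-out i else 0) + ℓ-in i ≡ (if S' i ∨ S i then ℓ i else 0)
        union i with S' i | S i
        ... | true  | true  = refl
        ... | true  | false = +-identityʳ (ℓ i)
        ... | false | _     = refl
        cover : ∀ v → ind (neighbour H (λ i → S' i ∨ S i) v) ≤ ind (neighbour H-out S' v) + ind (neighbour H S v)
        cover v rewrite neighbour-∨ H S' S v | neighbour-restrict H (λ v → not (neighbour H S v)) S' v
          with neighbour H S' v | neighbour H S v
        ... | true  | true  = ≤-refl
        ... | false | true  = ≤-refl
        ... | true  | false = ≤-refl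
        ... | false | false = z≤n

      combine : Matching H ℓ-in → Matching H-out ℓ-out → Matching H ℓ
      combine M-in M-out = record
        { partner           = partner′
        ; partner-adjacent  = adjacent
        ; partner-injective = injective
        }
        where
        side : ∀ {i j} → j < ℓ i → (S i ≡ true × j < ℓ-in i) ⊎ (S i ≡ false × j < ℓ-out i)
        side {i} p with S i
        ... | true  = inj₁ (refl , p)
        ... | false = inj₂ (refl , p)

        partner′ : ∀ i j → j < ℓ i → Fin n
        partner′ i j p with side p
        ... | inj₁ (_ , q) = partner M-in i j q
        ... | inj₂ (_ , q) = partner M-out i j q

        adjacent : ∀ i j p → H i (partner′ i j p) ≡ true
        adjacent i j p with side p
        ... | inj₁ (_ , q) = partner-adjacent M-in i j q
        ... | inj₂ (_ , q) = ∧-conicalˡ _ _ (partner-adjacent M-out i j q)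

        -- Partners of M-in lie in N(S), those of M-out avoid it.
        disjoint : ∀ {i j i' j'} q q' → S i ≡ true → partner M-in i j q ≢ partner M-out i' j' q'
        disjoint {i} {j} {i'} {j'} q q' Si same = contradiction (trans (cong not (sym in-N)) out-N) λ ()
          where
          in-N : neighbour H S (partner M-out i' j' q') ≡ true
          in-N = subst (λ v → neighbour H S v ≡ true) same (neighbour-intro H S i _ Si (partner-adjacent M-in i j q))
          out-N : not (neighbour H S (partner M-out i' j' q')) ≡ true
          out-N = ∧-conicalʳ _ _ (partner-adjacent M-out i' j' q')

        injective : ∀ {i j i' j'} p p' → partner′ i j p ≡ partner′ i' j' p' → i ≡ i' × j ≡ j'
        injective p p' same with side p | side p'
        ... | inj₁ (_ , q)  | inj₁ (_ , q')  = partner-injective M-in q q' same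
        ... | inj₂ (_ , q)  | inj₂ (_ , q')  = partner-injective M-out q q' same
        ... | inj₁ (Si , q) | inj₂ (_ , q')  = contradiction same (disjoint q q' Si)
        ... | inj₂ (_ , q)  | inj₁ (Si , q') = contradiction (sym same) (disjoint q' q Si)

    module Loose (H : BipGraph a n) (ℓ : Fin a → ℕ) (x : Fin a) (y : Fin n)
                 (ℓx>0 : 0 < ℓ x) (Hxy : H x y ≡ true) where

      ℓ′ : Fin a → ℕ
      ℓ′ = updateAt ℓ x pred

      H′ : BipGraph a n
      H′ = restrict H (λ v → not (does (v ≟ y)))

      weight-ℓ′ : ∀ S → weight ℓ S ≡ ind (S x) + weight ℓ′ S
      weight-ℓ′ S = begin
        weight ℓ S                                  ≡⟨ sumFin-remove a _ x ⟩
        (if S x then ℓ x else 0) + rest ℓ           ≡⟨ cong₂ _+_ at-x (sumFin-cong a off-x) ⟩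
        ind (S x) + (if S x then ℓ′ x else 0) + rest ℓ′ ≡⟨ +-assoc (ind (S x)) _ _ ⟩
        ind (S x) + ((if S x then ℓ′ x else 0) + rest ℓ′) ≡⟨ cong (ind (S x) +_) (sumFin-remove a _ x) ⟨
        ind (S x) + weight ℓ′ S                     ∎
        where
        open ≡-Reasoning
        rest : (Fin a → ℕ) → ℕ
        rest f = sumFin a (λ i → if does (i ≟ x) then 0 else (if S i then f i else 0))
        at-x : (if S x then ℓ x else 0) ≡ ind (S x) + (if S x then ℓ′ x else 0)
        at-x rewrite updateAt-updates x {pred} ℓ with S x
        ... | true  = sym (suc-pred (ℓ x) {{>-nonZero ℓx>0}})
        ... | false = refl
        off-x : ∀ i → (if does (i ≟ x) then 0 else (if S i then ℓ i else 0))
                    ≡ (if does (i ≟ x) then 0 else (if S i then ℓ′ i else 0))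
        off-x i with i ≟ x
        ... | yes _   = refl
        ... | no i≢x rewrite updateAt-minimal i x {pred} ℓ i≢x = refl

      ∣N∣≤1+∣N′∣ : ∀ S → ∣N∣ H S ≤ suc (∣N∣ H′ S)
      ∣N∣≤1+∣N′∣ S = begin
        ∣N∣ H S                                                     ≡⟨ countFin-remove n _ y ⟩
        ind (neighbour H S y) + countFin n (λ v → neighbour H S v ∧ not (does (v ≟ y)))
                                                                    ≤⟨ +-monoˡ-≤ _ (ind≤1 _) ⟩
        suc (countFin n (λ v → neighbour H S v ∧ not (does (v ≟ y)))) ≡⟨ cong suc (sumFin-cong n restricted) ⟩
        suc (∣N∣ H′ S)                                              ∎
        where
        open ≤-Reasoning
        restricted : ∀ v → ind (neighbour H S v ∧ not (does (v ≟ y))) ≡ ind (neighbour H′ S v)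
        restricted v = cong ind (sym (neighbour-restrict H (λ v → not (does (v ≟ y))) S v))

      hall′ : HallCondition H ℓ → (∀ S → S x ≡ false → 0 < weight ℓ S → weight ℓ S < ∣N∣ H S) →
              HallCondition H′ ℓ′
      hall′ hall surplus S with S x in Sx | weight-ℓ′ S
      ... | true  | w≡1+w′ = s≤s⁻¹ (≤-trans (subst (_≤ ∣N∣ H S) w≡1+w′ (hall S)) (∣N∣≤1+∣N′∣ S))
      ... | false | w≡w′   = subst (_≤ ∣N∣ H′ S) w≡w′ unchanged
        where
        unchanged : weight ℓ S ≤ ∣N∣ H′ S
        unchanged = [ (λ w>0 → s≤s⁻¹ (<-≤-trans (surplus S Sx w>0) (∣N∣≤1+∣N′∣ S)))
                    , (λ 0≡w → subst (_≤ ∣N∣ H′ S) 0≡w z≤n)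
                    ]′ (m≤n⇒m<n∨m≡n z≤n)

      extend : Matching H′ ℓ′ → Matching H ℓ
      extend M = record
        { partner           = partner′
        ; partner-adjacent  = adjacent
        ; partner-injective = injective
        }
        where
        last-slot : ∀ {i j} → j < ℓ i → (i ≡ x × j ≡ pred (ℓ x)) ⊎ j < ℓ′ i
        last-slot {i} {j} p with i ≟ x
        ... | no i≢x   = inj₂ (subst (j <_) (sym (updateAt-minimal i x ℓ i≢x)) p)
        ... | yes refl with j ℕ.≟ pred (ℓ x)
        ...   | yes j≡ = inj₁ (refl , j≡)
        ...   | no j≢  = inj₂ (subst (j <_) (sym (updateAt-updates x ℓ)) (≤∧≢⇒< (<⇒≤pred p) j≢))

        partner′ : ∀ i j → j < ℓ i → Fin n
        partner′ i j p with last-slot p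
        ... | inj₁ _ = y
        ... | inj₂ q = partner M i j q

        adjacent : ∀ i j p → H i (partner′ i j p) ≡ true
        adjacent i j p with last-slot p
        ... | inj₁ (refl , _) = Hxy
        ... | inj₂ q          = ∧-conicalˡ _ _ (partner-adjacent M i j q)

        avoids-y : ∀ {i j} q → y ≢ partner M i j q
        avoids-y {i} {j} q y≡ = contradiction (trans (cong (λ v → not (does (v ≟ y))) y≡) y∉) y-removed
          where
          y∉ : not (does (partner M i j q ≟ y)) ≡ true
          y∉ = ∧-conicalʳ _ _ (partner-adjacent M i j q)
          y-removed : not (does (y ≟ y)) ≢ true
          y-removed rewrite dec-true (y ≟ y) refl = λ ()

        injective : ∀ {i j i' j'} p p' → partner′ i j p ≡ partner′ i' j' p' → i ≡ i' × j ≡ j'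
        injective p p' same with last-slot p | last-slot p'
        ... | inj₁ (refl , j≡) | inj₁ (refl , j'≡) = refl , trans j≡ (sym j'≡)
        ... | inj₂ q           | inj₂ q'           = partner-injective M q q' same
        ... | inj₁ _           | inj₂ q'           = contradiction same (avoids-y q')
        ... | inj₂ q           | inj₁ _            = contradiction (sym same) (avoids-y q)

    TightAvoiding : BipGraph a n → (Fin a → ℕ) → Fin a → (Fin a → Bool) → Set
    TightAvoiding H ℓ x S = S x ≡ false × 0 < weight ℓ S × ∣N∣ H S ≤ weight ℓ S

    tight-avoiding? : ∀ H ℓ x → Dec (∃ (TightAvoiding H ℓ x))
    tight-avoiding? H ℓ x =
      any-subset? respects (λ S → (S x ≟ᵇ false) ×-dec (0 <? weight ℓ S) ×-dec (∣N∣ H S ≤? weight ℓ S))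
      where
      respects : ∀ {S S'} → (∀ i → S i ≡ S' i) → TightAvoiding H ℓ x S → TightAvoiding H ℓ x S'
      respects S≗S' (Sx , w>0 , tight) =
        trans (sym (S≗S' x)) Sx , subst (0 <_) (weight-cong ℓ S≗S') w>0 ,
        subst₂ _≤_ (∣N∣-cong H S≗S') (weight-cong ℓ S≗S') tight

    neighbour-exists : ∀ {H ℓ x} → HallCondition H ℓ → 0 < ℓ x → ∃ λ y → H x y ≡ true
    neighbour-exists {H} {ℓ} {x} hall ℓx>0 = adjacent (countFin-positive n _ (<-≤-trans ℓx>0 ℓx≤∣N⁅x⁆∣))
      where
      ⁅x⁆ : Fin a → Bool
      ⁅x⁆ i = does (i ≟ x)
      ℓx≤∣N⁅x⁆∣ : ℓ x ≤ ∣N∣ H ⁅x⁆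
      ℓx≤∣N⁅x⁆∣ = ≤-trans (subst (_≤ weight ℓ ⁅x⁆) (cong (if_then ℓ x else 0) (dec-true (x ≟ x) refl))
                                  (term≤sumFin a (ℓ ↾ ⁅x⁆) x))
                           (hall ⁅x⁆)
      adjacent : ∃ (λ y → neighbour H ⁅x⁆ y ≡ true) → ∃ λ y → H x y ≡ true
      adjacent (y , y∈N) with anyFin-elim a _ y∈N
      ... | i , i≟x∧Hiy with i ≟ x
      ...   | yes refl = y , ∧-conicalʳ _ _ i≟x∧Hiy

    -- Pick x with positive demand.  If some S ∌ x of positive
    -- demand is tight, match S inside N(S) and the other vertices outside N(S); otherwise serve
    -- one unit of x's demand by any neighbour y and remove y.
    hall-bounded : ∀ D H ℓ → sumFin a ℓ ≤ D → HallCondition H ℓ → Matching H ℓ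
    hall-bounded zero    H ℓ Σℓ≤0 hall =
      no-demand H ℓ λ i 0<ℓi → n≮0 (<-≤-trans 0<ℓi (≤-trans (term≤sumFin a ℓ i) Σℓ≤0))
    hall-bounded (suc D) H ℓ Σℓ≤1+D hall with any? (λ i → 0 <? ℓ i)
    ... | no none = no-demand H ℓ λ i 0<ℓi → none (i , 0<ℓi)
    ... | yes (x , ℓx>0) with tight-avoiding? H ℓ x
    ...   | yes (S , Sx , w>0 , tight) =
      combine (hall-bounded D H ℓ-in in≤D (hall-in hall)) (hall-bounded D H-out ℓ-out out≤D (hall-out hall tight))
      where
      open Tight H ℓ S
      out>0 : 0 < sumFin a ℓ-out
      out>0 = <-≤-trans (subst (λ b → 0 < (if b then 0 else ℓ x)) (sym Sx) ℓx>0) (term≤sumFin a ℓ-out x)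
      in+out≤1+D : weight ℓ S + sumFin a ℓ-out ≤ suc D
      in+out≤1+D = subst (_≤ suc D) sumFin-split Σℓ≤1+D
      in≤D : sumFin a ℓ-in ≤ D
      in≤D = s≤s⁻¹ (<-≤-trans (m<m+n _ out>0) in+out≤1+D)
      out≤D : sumFin a ℓ-out ≤ D
      out≤D = s≤s⁻¹ (<-≤-trans (m<n+m _ w>0) in+out≤1+D)
    ...   | no no-tight with neighbour-exists hall ℓx>0
    ...     | y , Hxy = extend (hall-bounded D H′ ℓ′ ℓ′≤D (hall′ hall surplus))
      where
      open Loose H ℓ x y ℓx>0 Hxy
      ℓ′≤D : sumFin a ℓ′ ≤ D
      ℓ′≤D = s≤s⁻¹ (subst (_≤ suc D) (weight-ℓ′ (λ _ → true)) Σℓ≤1+D)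
      surplus : ∀ S → S x ≡ false → 0 < weight ℓ S → weight ℓ S < ∣N∣ H S
      surplus S Sx w>0 = ≰⇒> (λ tight → no-tight (S , Sx , w>0 , tight))

    hall : ∀ H ℓ → HallCondition H ℓ → Matching H ℓ
    hall H ℓ = hall-bounded (sumFin a ℓ) H ℓ ≤-refl

module Loads where

  open import Defs
  open FiniteSums
  open CauchySchwarz
  open HallTheorem
  open import Data.Bool.Base using (true; false; if_then_else_; _∧_)
  open import Data.Fin.Base using (Fin)
  open import Data.Nat.Base using (ℕ; _+_; _*_; _≤_; _<_; _<ᵇ_; z≤n)
  open import Data.Nat.Properties hiding (_≟_)
  open import Data.Product.Base using (∃; _,_)
  open import Relation.Binary.PropositionalEquality

  module _ {k n : ℕ} (H : BipGraph k n) where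

    load : (Fin k → ℕ) → Fin n → ℕ
    load c v = sumFin k (λ i → if H i v then c i else 0)

    sumFin-load : ∀ c → sumFin n (load c) ≡ sumFin k (λ i → c i * degU H i)
    sumFin-load c = trans (sumFin-comm n k _) (sumFin-cong k λ i →
      trans (sumFin-cong n (λ v → if-then-0≡*ind (H i v) (c i))) (sym (*-distribˡ-sumFin n (c i) _)))

    sumFin-load² : ∀ c → sumFin n (λ v → load c v * load c v)
                       ≡ sumFin k (λ i → sumFin k (λ i' → c i * c i' * codeg H i i'))
    sumFin-load² c = begin
      sumFin n (λ v → load c v * load c v)
        ≡⟨ sumFin-cong n (λ v → trans (*-distribʳ-sumFin k (load c v) (t v))
                                      (sumFin-cong k (λ i → *-distribˡ-sumFin k (t v i) (t v)))) ⟩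
      sumFin n (λ v → sumFin k (λ i → sumFin k (λ i' → t v i * t v i')))
        ≡⟨ sumFin-comm n k _ ⟩
      sumFin k (λ i → sumFin n (λ v → sumFin k (λ i' → t v i * t v i')))
        ≡⟨ sumFin-cong k (λ i → sumFin-comm n k _) ⟩
      sumFin k (λ i → sumFin k (λ i' → sumFin n (λ v → t v i * t v i')))
        ≡⟨ sumFin-cong k (λ i → sumFin-cong k (λ i' →
             trans (sumFin-cong n (λ v → product (H i v) (H i' v) (c i) (c i')))
                   (sym (*-distribˡ-sumFin n (c i * c i') _)))) ⟩
      sumFin k (λ i → sumFin k (λ i' → c i * c i' * codeg H i i')) ∎
      where
      open ≡-Reasoning
      t : Fin n → Fin k → ℕ
      t v i = if H i v then c i else 0
      product : ∀ b b' x x' → (if b then x else 0) * (if b' then x' else 0) ≡ x * x' * ind (b ∧ b')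
      product true  true  x x' = sym (*-identityʳ (x * x'))
      product true  false x x' = trans (*-zeroʳ x) (sym (*-zeroʳ (x * x')))
      product false _     x x' = sym (*-zeroʳ (x * x'))

    degU≤support : ∀ c i → 0 < c i → degU H i ≤ support n (load c)
    degU≤support c i 0<ci = countFin-mono n (H i) _ λ v Hiv →
      0<⇒0<ᵇ (<-≤-trans 0<ci (subst (λ b → (if b then c i else 0) ≤ load c v) Hiv
                                          (term≤sumFin k (λ i' → if H i' v then c i' else 0) i)))

    support≤∣N∣ : ∀ ℓ S → support n (load (ℓ ↾ S)) ≤ ∣N∣ H S
    support≤∣N∣ ℓ S = countFin-mono n (λ v → 0 <ᵇ load (ℓ ↾ S) v) (neighbour H S) λ v load>0 →
      in-N v (sumFin-positive k (λ i → if H i v then (ℓ ↾ S) i else 0) (0<ᵇ⇒0< load>0))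
      where
      in-N : ∀ v → ∃ (λ i → 0 < (if H i v then (ℓ ↾ S) i else 0)) → neighbour H S v ≡ true
      in-N v (i , term>0) with S i in Si | H i v in Hiv
      ... | true | true = neighbour-intro H S i v Si Hiv

    load≡0⇒disjoint : ∀ ℓ S v → load (ℓ ↾ S) v ≡ 0 → weight ℓ S + load ℓ v ≤ sumFin k ℓ
    load≡0⇒disjoint ℓ S v load≡0 = begin
      weight ℓ S + load ℓ v                                ≡⟨ sumFin-distrib-+ k (ℓ ↾ S) (λ i → if H i v then ℓ i else 0) ⟨
      sumFin k (λ i → (ℓ ↾ S) i + (if H i v then ℓ i else 0)) ≤⟨ sumFin-mono-≤ k at-most-once ⟩
      sumFin k ℓ                                           ∎
      where
      open ≤-Reasoning
      at-most-once : ∀ i → (ℓ ↾ S) i + (if H i v then ℓ i else 0) ≤ ℓ i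
      at-most-once i with sumFin≡0⇒term≡0 k (λ i → if H i v then (ℓ ↾ S) i else 0) load≡0 i
      ... | term≡0 with S i | H i v
      ... | true  | true  = subst (λ l → l + l ≤ l) (sym term≡0) z≤n
      ... | true  | false = ≤-reflexive (+-identityʳ (ℓ i))
      ... | false | true  = ≤-refl
      ... | false | false = z≤n

module RationalArithmetic where

  open import Defs
  open FiniteSums
  open import Data.Fin.Base using (Fin; zero; suc)
  open import Data.Integer.Base as ℤ using (+_)
  import Data.Integer.Properties as ℤ
  open import Data.Nat.Base as ℕ using (ℕ; zero; suc)
  import Data.Nat.Coprimality as Coprime
  open import Data.Rational.Base
  open import Data.Rational.Properties
  open import Data.Rational.Solver using (module +-*-Solver)
  open +-*-Solver using (solve; _:=_; _:+_; _:*_; _:-_; con)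
  open import Data.Sum.Base using (inj₁; inj₂)
  open import Relation.Binary.PropositionalEquality
  open import Relation.Nullary.Negation using (¬_)

  ℕtoℚ-mkℚ : ∀ m → ℕtoℚ m ≡ mkℚ (+ m) 0 (Coprime.sym (Coprime.1-coprimeTo m))
  ℕtoℚ-mkℚ m = normalize-coprime (Coprime.sym (Coprime.1-coprimeTo m))

  +m*1 : ∀ m → + m ℤ.* + 1 ≡ + m
  +m*1 m = ℤ.*-identityʳ (+ m)

  ℕtoℚ-homo-+ : ∀ m n → ℕtoℚ (m ℕ.+ n) ≡ ℕtoℚ m + ℕtoℚ n
  ℕtoℚ-homo-+ m n = sym (trans (cong₂ _+_ (ℕtoℚ-mkℚ m) (ℕtoℚ-mkℚ n))
                               (cong (_/ 1) (cong₂ ℤ._+_ (+m*1 m) (+m*1 n))))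

  ℕtoℚ-homo-* : ∀ m n → ℕtoℚ (m ℕ.* n) ≡ ℕtoℚ m * ℕtoℚ n
  ℕtoℚ-homo-* m n = sym (trans (cong₂ _*_ (ℕtoℚ-mkℚ m) (ℕtoℚ-mkℚ n)) (cong (_/ 1) (ℤ.+◃n≡+n (m ℕ.* n))))

  ℕtoℚ-mono-≤ : ∀ {m n} → m ℕ.≤ n → ℕtoℚ m ≤ ℕtoℚ n
  ℕtoℚ-mono-≤ {m} {n} m≤n rewrite ℕtoℚ-mkℚ m | ℕtoℚ-mkℚ n =
    *≤* (subst₂ ℤ._≤_ (sym (+m*1 m)) (sym (+m*1 n)) (ℤ.+≤+ m≤n))

  ℕtoℚ-cancel-≤ : ∀ {m n} → ℕtoℚ m ≤ ℕtoℚ n → m ℕ.≤ n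
  ℕtoℚ-cancel-≤ {m} {n} le rewrite ℕtoℚ-mkℚ m | ℕtoℚ-mkℚ n with le
  ... | *≤* le′ = ℤ.drop‿+≤+ (subst₂ ℤ._≤_ (+m*1 m) (+m*1 n) le′)

  ℕtoℚ-mono-< : ∀ {m n} → m ℕ.< n → ℕtoℚ m < ℕtoℚ n
  ℕtoℚ-mono-< {m} {n} m<n rewrite ℕtoℚ-mkℚ m | ℕtoℚ-mkℚ n =
    *<* (subst₂ ℤ._<_ (sym (+m*1 m)) (sym (+m*1 n)) (ℤ.+<+ m<n))

  0≤ℕtoℚ : ∀ n → 0ℚ ≤ ℕtoℚ n
  0≤ℕtoℚ n = ℕtoℚ-mono-≤ {0} {n} ℕ.z≤n

  *-monoˡ-≤-nonNeg′ : ∀ {r p q} → 0ℚ ≤ r → p ≤ q → r * p ≤ r * q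
  *-monoˡ-≤-nonNeg′ {r} 0≤r = *-monoˡ-≤-nonNeg r {{nonNegative 0≤r}}

  *-monoʳ-≤-nonNeg′ : ∀ {r p q} → 0ℚ ≤ r → p ≤ q → p * r ≤ q * r
  *-monoʳ-≤-nonNeg′ {r} 0≤r = *-monoʳ-≤-nonNeg r {{nonNegative 0≤r}}

  *-mono-≤-nonNeg : ∀ {p q r s} → 0ℚ ≤ p → 0ℚ ≤ r → p ≤ q → r ≤ s → p * r ≤ q * s
  *-mono-≤-nonNeg 0≤p 0≤r p≤q r≤s =
    ≤-trans (*-monoʳ-≤-nonNeg′ 0≤r p≤q) (*-monoˡ-≤-nonNeg′ (≤-trans 0≤p p≤q) r≤s)

  *-cancelˡ-≤-pos′ : ∀ {r p q} → 0ℚ < r → r * p ≤ r * q → p ≤ q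
  *-cancelˡ-≤-pos′ {r} 0<r = *-cancelˡ-≤-pos r {{positive 0<r}}

  *-nonNeg : ∀ {p q} → 0ℚ ≤ p → 0ℚ ≤ q → 0ℚ ≤ p * q
  *-nonNeg {p} {q} 0≤p 0≤q = subst (_≤ p * q) (*-zeroˡ q) (*-monoʳ-≤-nonNeg′ 0≤q 0≤p)

  *-pos : ∀ {p q} → 0ℚ < p → 0ℚ < q → 0ℚ < p * q
  *-pos {p} {q} 0<p 0<q = positive⁻¹ (p * q) {{pos*pos⇒pos p {{positive 0<p}} q {{positive 0<q}}}}

  p≤1⇒q*p≤q : ∀ {p q} → 0ℚ ≤ q → p ≤ 1ℚ → q * p ≤ q
  p≤1⇒q*p≤q {p} {q} 0≤q p≤1 = ≤-trans (*-monoˡ-≤-nonNeg′ 0≤q p≤1) (≤-reflexive (*-identityʳ q))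

  p-q+q≡p : ∀ p q → p - q + q ≡ p
  p-q+q≡p = solve 2 (λ p q → p :- q :+ q := p) refl

  p≤p+q : ∀ {p q} → 0ℚ ≤ q → p ≤ p + q
  p≤p+q {p} 0≤q = ≤-trans (≤-reflexive (sym (+-identityʳ p))) (+-monoʳ-≤ p 0≤q)

  p≤q+p : ∀ {p q} → 0ℚ ≤ q → p ≤ q + p
  p≤q+p {p} {q} 0≤q = subst (p ≤_) (+-comm p q) (p≤p+q 0≤q)

  p-q≤p : ∀ {p q} → 0ℚ ≤ q → p - q ≤ p
  p-q≤p {p} {q} 0≤q = ≤-trans (+-monoʳ-≤ p (neg-antimono-≤ 0≤q)) (≤-reflexive (+-identityʳ p))

  p+q≤r⇒p≤r-q : ∀ {p q r} → p + q ≤ r → p ≤ r - q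
  p+q≤r⇒p≤r-q {p} {q} {r} p+q≤r = subst (_≤ r - q) (cancel p q) (+-monoˡ-≤ (- q) p+q≤r)
    where
    cancel : ∀ p q → p + q - q ≡ p
    cancel = solve 2 (λ p q → p :+ q :- q := p) refl

  p≤q⇒0≤q-p : ∀ {p q} → p ≤ q → 0ℚ ≤ q - p
  p≤q⇒0≤q-p {p} p≤q = p+q≤r⇒p≤r-q (≤-trans (≤-reflexive (+-identityˡ p)) p≤q)

  0≤q-p⇒p≤q : ∀ {p q} → 0ℚ ≤ q - p → p ≤ q
  0≤q-p⇒p≤q {p} {q} 0≤q-p = subst₂ _≤_ (+-identityˡ p) (p-q+q≡p q p) (+-monoˡ-≤ p 0≤q-p)

  p≤∣p∣ : ∀ p → p ≤ ∣ p ∣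
  p≤∣p∣ p with ≤-total 0ℚ p
  ... | inj₁ 0≤p = ≤-reflexive (sym (0≤p⇒∣p∣≡p 0≤p))
  ... | inj₂ p≤0 = ≤-trans p≤0 (0≤∣p∣ p)

  r≮∣p-q∣⇒p≤q+r : ∀ {p q r} → ¬ (r < ∣ p - q ∣) → p ≤ q + r
  r≮∣p-q∣⇒p≤q+r {p} {q} {r} r≮∣p-q∣ = subst₂ _≤_ (p-q+q≡p p q) (+-comm r q) (+-monoˡ-≤ q p-q≤r)
    where
    p-q≤r : p - q ≤ r
    p-q≤r = ≤-trans (p≤∣p∣ (p - q)) (≮⇒≥ r≮∣p-q∣)

  sumFin-≤-affine : ∀ k r (f g h : Fin k → ℕ) →
                    (∀ i → ℕtoℚ (f i) ≤ r * ℕtoℚ (g i) + ℕtoℚ (h i)) →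
                    ℕtoℚ (sumFin k f) ≤ r * ℕtoℚ (sumFin k g) + ℕtoℚ (sumFin k h)
  sumFin-≤-affine zero    r f g h _ = ≤-reflexive (sym (trans (cong (_+ 0ℚ) (*-zeroʳ r)) (+-identityʳ 0ℚ)))
  sumFin-≤-affine (suc k) r f g h f≤ = begin
    ℕtoℚ (f zero ℕ.+ F)
      ≡⟨ ℕtoℚ-homo-+ (f zero) F ⟩
    ℕtoℚ (f zero) + ℕtoℚ F
      ≤⟨ +-mono-≤ (f≤ zero) (sumFin-≤-affine k r _ _ _ (λ i → f≤ (suc i))) ⟩
    (r * ℕtoℚ (g zero) + ℕtoℚ (h zero)) + (r * ℕtoℚ G + ℕtoℚ Hs)
      ≡⟨ regroup r (ℕtoℚ (g zero)) (ℕtoℚ (h zero)) (ℕtoℚ G) (ℕtoℚ Hs) ⟩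
    r * (ℕtoℚ (g zero) + ℕtoℚ G) + (ℕtoℚ (h zero) + ℕtoℚ Hs)
      ≡⟨ cong₂ (λ a b → r * a + b) (ℕtoℚ-homo-+ (g zero) G) (ℕtoℚ-homo-+ (h zero) Hs) ⟨
    r * ℕtoℚ (g zero ℕ.+ G) + ℕtoℚ (h zero ℕ.+ Hs) ∎
    where
    open ≤-Reasoning
    F = sumFin k (λ i → f (suc i))
    G = sumFin k (λ i → g (suc i))
    Hs = sumFin k (λ i → h (suc i))
    regroup : ∀ r a b c d → (r * a + b) + (r * c + d) ≡ r * (a + c) + (b + d)
    regroup = solve 5 (λ r a b c d → (r :* a :+ b) :+ (r :* c :+ d) := r :* (a :+ c) :+ (b :+ d)) refl

  sumFin-≥-linear : ∀ k r (f g : Fin k → ℕ) →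
                    (∀ i → r * ℕtoℚ (g i) ≤ ℕtoℚ (f i)) → r * ℕtoℚ (sumFin k g) ≤ ℕtoℚ (sumFin k f)
  sumFin-≥-linear zero    r f g _ = ≤-reflexive (*-zeroʳ r)
  sumFin-≥-linear (suc k) r f g ≤f = begin
    r * ℕtoℚ (g zero ℕ.+ G)               ≡⟨ cong (r *_) (ℕtoℚ-homo-+ (g zero) G) ⟩
    r * (ℕtoℚ (g zero) + ℕtoℚ G)          ≡⟨ *-distribˡ-+ r _ _ ⟩
    r * ℕtoℚ (g zero) + r * ℕtoℚ G        ≤⟨ +-mono-≤ (≤f zero) (sumFin-≥-linear k r _ _ (λ i → ≤f (suc i))) ⟩
    ℕtoℚ (f zero) + ℕtoℚ F                ≡⟨ ℕtoℚ-homo-+ (f zero) F ⟨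
    ℕtoℚ (f zero ℕ.+ F)                   ∎
    where
    open ≤-Reasoning
    F = sumFin k (λ i → f (suc i))
    G = sumFin k (λ i → g (suc i))

  mean²≤second-moment : ∀ {c x y A Q} → 0ℚ ≤ c → 0ℚ < x → y ≤ x → 0ℚ ≤ Q →
                        c * x ≤ A → A * A ≤ y * Q → c * c * x ≤ Q
  mean²≤second-moment {c} {x} {y} {A} {Q} 0≤c 0<x y≤x 0≤Q cx≤A A²≤yQ = *-cancelˡ-≤-pos′ 0<x (begin
    x * (c * c * x)   ≡⟨ regroup c x ⟨
    (c * x) * (c * x) ≤⟨ *-mono-≤-nonNeg 0≤cx 0≤cx cx≤A cx≤A ⟩
    A * A             ≤⟨ A²≤yQ ⟩
    y * Q             ≤⟨ *-monoʳ-≤-nonNeg′ 0≤Q y≤x ⟩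
    x * Q             ∎)
    where
    open ≤-Reasoning
    0≤cx : 0ℚ ≤ c * x
    0≤cx = *-nonNeg 0≤c (<⇒≤ 0<x)
    regroup : ∀ c x → (c * x) * (c * x) ≡ x * (c * c * x)
    regroup = solve 2 (λ c x → (c :* x) :* (c :* x) := x :* (c :* c :* x)) refl

  density-inequality : ∀ {δ ρ ε N x Q} → 0ℚ ≤ δ → 0ℚ ≤ ρ → 0ℚ ≤ ε → 0ℚ ≤ N → 0ℚ < x →
                       δ * N ≤ x → x + δ * N ≤ N →
                       (δ * N) * (δ * N) * x ≤ Q → Q ≤ N * (ρ * x * x + ε * N * N) →
                       δ * δ * δ ≤ δ * ρ * (1ℚ - δ) + ε
  density-inequality {δ} {ρ} {ε} {N} {x} {Q} 0≤δ 0≤ρ 0≤ε 0≤N 0<x δN≤x x+δN≤N δN²x≤Q Q≤ =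
    *-cancelˡ-≤-pos′ (*-pos 0<N 0<x) (begin
      (N * x) * (δ * δ * δ)                  ≡⟨ regroup₁ δ N x ⟩
      δ * (δ * δ * N * x)                    ≤⟨ *-monoˡ-≤-nonNeg′ 0≤δ δ²Nx≤ ⟩
      δ * (ρ * x * x + ε * N * N)            ≡⟨ regroup₂ δ ρ ε N x ⟩
      δ * ρ * x * x + ε * N * (δ * N)        ≤⟨ +-mono-≤ (*-monoˡ-≤-nonNeg′ 0≤δρx x≤[1-δ]N)
                                                         (*-monoˡ-≤-nonNeg′ (*-nonNeg 0≤ε 0≤N) δN≤x) ⟩
      δ * ρ * x * ((1ℚ - δ) * N) + ε * N * x ≡⟨ regroup₃ δ ρ ε N x ⟩
      (N * x) * (δ * ρ * (1ℚ - δ) + ε)       ∎)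
    where
    open ≤-Reasoning
    0<N : 0ℚ < N
    0<N = <-≤-trans 0<x (≤-trans (p≤p+q (*-nonNeg 0≤δ 0≤N)) x+δN≤N)
    δ²Nx≤ : δ * δ * N * x ≤ ρ * x * x + ε * N * N
    δ²Nx≤ = *-cancelˡ-≤-pos′ 0<N (≤-trans (≤-reflexive (regroup₀ δ N x)) (≤-trans δN²x≤Q Q≤))
      where
      regroup₀ : ∀ δ N x → N * (δ * δ * N * x) ≡ (δ * N) * (δ * N) * x
      regroup₀ = solve 3 (λ δ N x → N :* (δ :* δ :* N :* x) := (δ :* N) :* (δ :* N) :* x) refl
    0≤δρx : 0ℚ ≤ δ * ρ * x
    0≤δρx = *-nonNeg (*-nonNeg 0≤δ 0≤ρ) (<⇒≤ 0<x)
    x≤[1-δ]N : x ≤ (1ℚ - δ) * N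
    x≤[1-δ]N = subst (x ≤_) (factor δ N) (p+q≤r⇒p≤r-q x+δN≤N)
      where
      factor : ∀ δ N → N - δ * N ≡ (1ℚ - δ) * N
      factor = solve 2 (λ δ N → N :- δ :* N := (con 1ℚ :- δ) :* N) refl
    regroup₁ : ∀ δ N x → (N * x) * (δ * δ * δ) ≡ δ * (δ * δ * N * x)
    regroup₁ = solve 3 (λ δ N x → (N :* x) :* (δ :* δ :* δ) := δ :* (δ :* δ :* N :* x)) refl
    regroup₂ : ∀ δ ρ ε N x → δ * (ρ * x * x + ε * N * N) ≡ δ * ρ * x * x + ε * N * (δ * N)
    regroup₂ = solve 5 (λ δ ρ ε N x → δ :* (ρ :* x :* x :+ ε :* N :* N)
                                      := δ :* ρ :* x :* x :+ ε :* N :* (δ :* N)) refl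
    regroup₃ : ∀ δ ρ ε N x → δ * ρ * x * ((1ℚ - δ) * N) + ε * N * x ≡ (N * x) * (δ * ρ * (1ℚ - δ) + ε)
    regroup₃ = solve 5 (λ δ ρ ε N x → δ :* ρ :* x :* ((con 1ℚ :- δ) :* N) :+ ε :* N :* x
                                      := (N :* x) :* (δ :* ρ :* (con 1ℚ :- δ) :+ ε)) refl

module Parameters where

  open RationalArithmetic
  import Data.Integer.Base as ℤ
  open import Data.Rational.Base
  open import Data.Rational.Properties
  open import Data.Rational.Solver using (module +-*-Solver)
  open +-*-Solver using (solve; _:=_; _:+_; _:*_; _:-_; con)
  open import Relation.Binary.PropositionalEquality
  open import Relation.Nullary.Decidable.Core using (toWitness)

  -- Spelled as in JEdge, so that the two agree definitionally.
  three : ℚ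
  three = ℤ.+ 3 / 1

  ⅛ : ℚ
  ⅛ = ½ * ½ * ½

  -- With h = d/2, the bound ε ≤ h⁴/8 gives ε ≤ h, hence h ≤ d - ε, and then 7ε < h⁴ ≤ (d - ε)⁴.
  ε₀ : ℚ → ℚ
  ε₀ d = ⅛ * (h * h * h * h)
    where h = ½ * d

  0<ε₀ : ∀ {d} → 0ℚ < d → 0ℚ < ε₀ d
  0<ε₀ 0<d = *-pos (toWitness {a? = 0ℚ <? ⅛} _) (*-pos (*-pos (*-pos 0<h 0<h) 0<h) 0<h)
    where
    0<h = *-pos (toWitness {a? = 0ℚ <? ½} _) 0<d

  module _ {d ε : ℚ} (0<d : 0ℚ < d) (d<1 : d < 1ℚ) (0<ε : 0ℚ < ε) (ε≤ε₀ : ε ≤ ε₀ d) where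

    private
      h = ½ * d
      δ = d - ε
      0<h : 0ℚ < h
      0<h = *-pos (toWitness {a? = 0ℚ <? ½} _) 0<d
      0≤h = <⇒≤ 0<h
      0≤ε = <⇒≤ 0<ε
      h+h≡d : h + h ≡ d
      h+h≡d = trans (sym (*-distribʳ-+ d ½ ½)) (*-identityˡ d)
      six = three + three

    ½d≤d-ε : h ≤ δ
    ½d≤d-ε = p+q≤r⇒p≤r-q (≤-trans (+-monoʳ-≤ h ε≤h) (≤-reflexive h+h≡d))
      where
      h≤1 : h ≤ 1ℚ
      h≤1 = ≤-trans (p≤p+q 0≤h) (≤-trans (≤-reflexive h+h≡d) (<⇒≤ d<1))
      ε≤h : ε ≤ h
      ε≤h = begin
        ε                   ≤⟨ ε≤ε₀ ⟩
        ⅛ * (h * h * h * h) ≡⟨ *-comm ⅛ (h * h * h * h) ⟩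
        h * h * h * h * ⅛   ≤⟨ p≤1⇒q*p≤q (*-nonNeg (*-nonNeg (*-nonNeg 0≤h 0≤h) 0≤h) 0≤h)
                                         (toWitness {a? = ⅛ ≤? 1ℚ} _) ⟩
        h * h * h * h       ≤⟨ p≤1⇒q*p≤q (*-nonNeg (*-nonNeg 0≤h 0≤h) 0≤h) h≤1 ⟩
        h * h * h           ≤⟨ p≤1⇒q*p≤q (*-nonNeg 0≤h 0≤h) h≤1 ⟩
        h * h               ≤⟨ p≤1⇒q*p≤q 0≤h h≤1 ⟩
        h                   ∎
        where open ≤-Reasoning

    0≤δ : 0ℚ ≤ δ
    0≤δ = ≤-trans 0≤h ½d≤d-ε

    ρ≤δ²+6ε : d * d + three * ε ≤ δ * δ + six * ε
    ρ≤δ²+6ε = 0≤q-p⇒p≤q (subst (0ℚ ≤_) (gap d ε three) (*-nonNeg 0≤ε slack))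
      where
      0≤1-d = p≤q⇒0≤q-p (<⇒≤ d<1)
      slack : 0ℚ ≤ ε + (1ℚ - d) + (1ℚ - d) + (three - 1ℚ - 1ℚ)
      slack = +-mono-≤ (+-mono-≤ (+-mono-≤ 0≤ε 0≤1-d) 0≤1-d) (toWitness {a? = 0ℚ ≤? three - 1ℚ - 1ℚ} _)
      gap : ∀ d ε t → ε * (ε + (1ℚ - d) + (1ℚ - d) + (t - 1ℚ - 1ℚ))
                    ≡ ((d - ε) * (d - ε) + (t + t) * ε) - (d * d + t * ε)
      gap = solve 3 (λ d ε t → ε :* (ε :+ (con 1ℚ :- d) :+ (con 1ℚ :- d) :+ (t :- con 1ℚ :- con 1ℚ))
                              := ((d :- ε) :* (d :- ε) :+ (t :+ t) :* ε) :- (d :* d :+ t :* ε)) refl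

    7ε<δ⁴ : (six + 1ℚ) * ε < δ * δ * δ * δ
    7ε<δ⁴ = begin-strict
      (six + 1ℚ) * ε          ≤⟨ *-monoˡ-≤-nonNeg′ (toWitness {a? = 0ℚ ≤? six + 1ℚ} _) ε≤ε₀ ⟩
      (six + 1ℚ) * (⅛ * h⁴)   ≡⟨ *-assoc (six + 1ℚ) ⅛ h⁴ ⟨
      ((six + 1ℚ) * ⅛) * h⁴   <⟨ *-monoˡ-<-pos h⁴ {{positive 0<h⁴}} (toWitness {a? = (six + 1ℚ) * ⅛ <? 1ℚ} _) ⟩
      1ℚ * h⁴                 ≡⟨ *-identityˡ h⁴ ⟩
      h⁴                      ≤⟨ *-mono-≤-nonNeg 0≤h³ 0≤h (*-mono-≤-nonNeg 0≤h² 0≤h h²≤δ² ½d≤d-ε) ½d≤d-ε ⟩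
      δ * δ * δ * δ           ∎
      where
      open ≤-Reasoning
      h⁴ = h * h * h * h
      0≤h² = *-nonNeg 0≤h 0≤h
      0≤h³ = *-nonNeg 0≤h² 0≤h
      h²≤δ² = *-mono-≤-nonNeg 0≤h 0≤h ½d≤d-ε ½d≤d-ε
      0<h⁴ : 0ℚ < h⁴
      0<h⁴ = *-pos (*-pos (*-pos 0<h 0<h) 0<h) 0<h

    density-violated : δ * (d * d + three * ε) * (1ℚ - δ) + ε < δ * δ * δ
    density-violated = begin-strict
      δ * (d * d + three * ε) * (1ℚ - δ) + ε
                                               ≤⟨ +-monoˡ-≤ ε (*-monoʳ-≤-nonNeg′ 0≤1-δ (*-monoˡ-≤-nonNeg′ 0≤δ ρ≤δ²+6ε)) ⟩
      δ * (δ * δ + six * ε) * (1ℚ - δ) + ε     ≡⟨ expand δ (six * ε) ε ⟩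
      δ³-δ⁴ + (six * ε * (δ * (1ℚ - δ)) + ε)   ≤⟨ +-monoʳ-≤ δ³-δ⁴ (+-monoˡ-≤ ε (p≤1⇒q*p≤q 0≤6ε δ[1-δ]≤1)) ⟩
      δ³-δ⁴ + (six * ε + ε)                    ≡⟨ cong (δ³-δ⁴ +_) (collect six ε) ⟩
      δ³-δ⁴ + (six + 1ℚ) * ε                   <⟨ +-monoʳ-< δ³-δ⁴ 7ε<δ⁴ ⟩
      δ³-δ⁴ + δ * δ * δ * δ                    ≡⟨ p-q+q≡p (δ * δ * δ) (δ * δ * δ * δ) ⟩
      δ * δ * δ                                ∎
      where
      open ≤-Reasoning
      δ³-δ⁴ = δ * δ * δ - δ * δ * δ * δ
      0≤6ε : 0ℚ ≤ six * ε
      0≤6ε = *-nonNeg (toWitness {a? = 0ℚ ≤? six} _) 0≤ε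
      0≤1-δ : 0ℚ ≤ 1ℚ - δ
      0≤1-δ = p≤q⇒0≤q-p (≤-trans (p-q≤p 0≤ε) (<⇒≤ d<1))
      δ[1-δ]≤1 : δ * (1ℚ - δ) ≤ 1ℚ
      δ[1-δ]≤1 = *-mono-≤-nonNeg 0≤δ 0≤1-δ (≤-trans (p-q≤p 0≤ε) (<⇒≤ d<1)) (p-q≤p 0≤δ)
      expand : ∀ δ e ε → δ * (δ * δ + e) * (1ℚ - δ) + ε
                         ≡ (δ * δ * δ - δ * δ * δ * δ) + (e * (δ * (1ℚ - δ)) + ε)
      expand = solve 3 (λ δ e ε → δ :* (δ :* δ :+ e) :* (con 1ℚ :- δ) :+ ε
                                  := (δ :* δ :* δ :- δ :* δ :* δ :* δ) :+ (e :* (δ :* (con 1ℚ :- δ)) :+ ε)) refl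
      collect : ∀ s ε → s * ε + ε ≡ (s + 1ℚ) * ε
      collect = solve 2 (λ s ε → s :* ε :+ ε := (s :+ con 1ℚ) :* ε) refl

module Regularity where

  open import Defs
  open FiniteSums
  open CauchySchwarz
  open HallTheorem
  open Loads
  open RationalArithmetic
  open Parameters
  open import Data.Bool.Base using (Bool; true; false; if_then_else_; not)
  open import Data.Empty using (⊥)
  open import Data.Fin.Base using (Fin)
  open import Data.Fin.Properties using (any?)
  open import Data.Nat.Base as ℕ using (ℕ; _<ᵇ_)
  import Data.Nat.Properties as ℕ
  open import Data.Product.Base using (∃; _,_; proj₁)
  open import Data.Rational.Base
  open import Data.Rational.Properties
  open import Data.Rational.Solver using (module +-*-Solver)
  open +-*-Solver using (solve; _:=_; _:+_; _:*_; _:-_)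
  open import Data.Sum.Base using ([_,_]′)
  open import Relation.Binary.PropositionalEquality
  open import Relation.Nullary.Decidable using (isYes≗does; dec-true; dec-false)
  open import Relation.Nullary.Decidable.Core using (Dec; _×-dec_; toWitness; toSum; decidable-stable)
  open import Relation.Nullary.Negation using (¬_; contradiction)

  codeg≤ : ∀ {m n} (G : BipGraph m n) d ε u u' → jedge? G d ε u u' ≡ false →
           ℕtoℚ (codeg G u u') ≤ (d * d + three * ε) * ℕtoℚ n
  codeg≤ {n = n} G d ε u u' regular = subst (ℕtoℚ (codeg G u u') ≤_) (factor d ε (ℕtoℚ n) three)
    (r≮∣p-q∣⇒p≤q+r λ deviates →
      contradiction (trans (sym regular) (trans (isYes≗does jedge) (dec-true jedge deviates))) λ ())
    where
    jedge = three * ε * ℕtoℚ n <? ∣ ℕtoℚ (codeg G u u') - d * d * ℕtoℚ n ∣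
    factor : ∀ d ε N t → d * d * N + t * ε * N ≡ (d * d + t * ε) * N
    factor = solve 4 (λ d ε N t → d :* d :* N :+ t :* ε :* N := (d :* d :+ t :* ε) :* N) refl

  module _ {m n : ℕ} (G : BipGraph m n) (F : StarForest) (ψ : Cen F → Fin m) (d ε ν : ℚ)
    (0<d : 0ℚ < d) (d<1 : d < 1ℚ) (0<ε : 0ℚ < ε) (ε≤ε₀ : ε ≤ ε₀ d)
    (leaves≤n : numLeaves F ℕ.≤ n)
    (degrees : ∀ u → ℕtoℚ (degU G u) ≈ d * ℕtoℚ n ± ε * ℕtoℚ n)
    (loads : ∀ v → ν * ℕtoℚ n ≤ ℕtoℚ (weightAt G F ψ v))
    (few-bad : ℕtoℚ (badCount G d ε F ψ) ≤ ν * ℕtoℚ n)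
    (irregular : ℕtoℚ (irregularWeight G d ε F ψ) ≤ ε * ℕtoℚ n * ℕtoℚ n)
    where

    private
      N = ℕtoℚ n
      δ = d - ε
      ρ = d * d + three * ε
      K = k F
      H : BipGraph K n
      H i v = G (ψ i) v

      Good : Fin n → Set
      Good v = ℕtoℚ (weightAt G F ψ v) ≈ d * N ± ε * N

      good? : ∀ v → Dec (Good v)
      good? v = _≈?_±_ (ℕtoℚ (weightAt G F ψ v)) (d * N) (ε * N)

      δN≤ : ∀ {a} → d * N - ε * N ≤ a → δ * N ≤ a
      δN≤ = subst (_≤ _) (factor d ε N)
        where
        factor : ∀ d ε N → d * N - ε * N ≡ (d - ε) * N
        factor = solve 3 (λ d ε N → d :* N :- ε :* N := (d :- ε) :* N) refl

      0≤ρ : 0ℚ ≤ ρ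
      0≤ρ = +-mono-≤ (*-nonNeg (<⇒≤ 0<d) (<⇒≤ 0<d)) (*-nonNeg (toWitness {a? = 0ℚ ≤? three} _) (<⇒≤ 0<ε))

      first-moment≥ : ∀ S → δ * N * ℕtoℚ (weight (ℓ F) S) ≤ ℕtoℚ (sumFin n (load H (ℓ F ↾ S)))
      first-moment≥ S = subst (δ * N * ℕtoℚ (weight (ℓ F) S) ≤_) (cong ℕtoℚ (sym (sumFin-load H c)))
        (sumFin-≥-linear K (δ * N) (λ i → c i ℕ.* degU H i) c λ i → begin
          δ * N * ℕtoℚ (c i)                ≡⟨ *-comm (δ * N) (ℕtoℚ (c i)) ⟩
          ℕtoℚ (c i) * (δ * N)              ≤⟨ *-monoˡ-≤-nonNeg′ (0≤ℕtoℚ (c i)) (δN≤ (proj₁ (degrees (ψ i)))) ⟩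
          ℕtoℚ (c i) * ℕtoℚ (degU H i)      ≡⟨ ℕtoℚ-homo-* (c i) (degU H i) ⟨
          ℕtoℚ (c i ℕ.* degU H i)           ∎)
        where
        open ≤-Reasoning
        c = ℓ F ↾ S

      irr : Fin K → Fin K → ℕ
      irr i i' = if jedge? G d ε (ψ i) (ψ i') then ℓ F i ℕ.* ℓ F i' else 0

      pair-bound : ∀ S i i' b → jedge? G d ε (ψ i) (ψ i') ≡ b →
                   ℕtoℚ ((ℓ F ↾ S) i ℕ.* (ℓ F ↾ S) i' ℕ.* codeg H i i')
                     ≤ ρ * N * ℕtoℚ ((ℓ F ↾ S) i ℕ.* (ℓ F ↾ S) i')
                       + ℕtoℚ (n ℕ.* (if b then ℓ F i ℕ.* ℓ F i' else 0))
      pair-bound S i i' false regular = begin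
        ℕtoℚ (cc′ ℕ.* codeg H i i')               ≡⟨ ℕtoℚ-homo-* cc′ (codeg H i i') ⟩
        ℕtoℚ cc′ * ℕtoℚ (codeg H i i')            ≤⟨ *-monoˡ-≤-nonNeg′ (0≤ℕtoℚ cc′)
                                                                        (codeg≤ G d ε (ψ i) (ψ i') regular) ⟩
        ℕtoℚ cc′ * (ρ * N)                        ≡⟨ *-comm (ℕtoℚ cc′) (ρ * N) ⟩
        ρ * N * ℕtoℚ cc′                          ≤⟨ p≤p+q (0≤ℕtoℚ (n ℕ.* 0)) ⟩
        ρ * N * ℕtoℚ cc′ + ℕtoℚ (n ℕ.* 0)         ∎
        where
        open ≤-Reasoning
        cc′ = (ℓ F ↾ S) i ℕ.* (ℓ F ↾ S) i'
      pair-bound S i i' true _ =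
        ≤-trans (ℕtoℚ-mono-≤ cc′codeg≤nℓℓ′) (p≤q+p (*-nonNeg (*-nonNeg 0≤ρ (0≤ℕtoℚ n)) (0≤ℕtoℚ cc′)))
        where
        cc′ = (ℓ F ↾ S) i ℕ.* (ℓ F ↾ S) i'
        cc′codeg≤nℓℓ′ : (ℓ F ↾ S) i ℕ.* (ℓ F ↾ S) i' ℕ.* codeg H i i' ℕ.≤ n ℕ.* (ℓ F i ℕ.* ℓ F i')
        cc′codeg≤nℓℓ′ = ℕ.≤-trans (ℕ.*-mono-≤ (ℕ.*-mono-≤ (↾≤ (ℓ F) S i) (↾≤ (ℓ F) S i')) (countFin≤ n _))
                                  (ℕ.≤-reflexive (ℕ.*-comm (ℓ F i ℕ.* ℓ F i') n))

      second-moment≤ : ∀ S → ℕtoℚ (sumFin n (λ v → load H (ℓ F ↾ S) v ℕ.* load H (ℓ F ↾ S) v))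
                           ≤ N * (ρ * ℕtoℚ (weight (ℓ F) S) * ℕtoℚ (weight (ℓ F) S) + ε * N * N)
      second-moment≤ S = begin
        ℕtoℚ (sumFin n (λ v → load H c v ℕ.* load H c v))
          ≡⟨ cong ℕtoℚ (sumFin-load² H c) ⟩
        ℕtoℚ (sumFin K (λ i → sumFin K (λ i' → c i ℕ.* c i' ℕ.* codeg H i i')))
          ≤⟨ sumFin-≤-affine K (ρ * N) (λ i → sumFin K (λ i' → c i ℕ.* c i' ℕ.* codeg H i i'))
               (λ i → sumFin K (λ i' → c i ℕ.* c i')) (λ i → sumFin K (λ i' → n ℕ.* irr i i'))
               (λ i → sumFin-≤-affine K (ρ * N) (λ i' → c i ℕ.* c i' ℕ.* codeg H i i') (λ i' → c i ℕ.* c i')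
                                      (λ i' → n ℕ.* irr i i') (λ i' → pair-bound S i i' _ refl)) ⟩
        ρ * N * ℕtoℚ (sumFin K (λ i → sumFin K (λ i' → c i ℕ.* c i')))
          + ℕtoℚ (sumFin K (λ i → sumFin K (λ i' → n ℕ.* irr i i')))
          ≡⟨ cong₂ (λ p q → ρ * N * p + q) (cong ℕtoℚ (sym (sumFin-square K c)))
                   (cong ℕtoℚ (sym (trans (*-distribˡ-sumFin K n _)
                                          (sumFin-cong K (λ i → *-distribˡ-sumFin K n (irr i)))))) ⟩
        ρ * N * ℕtoℚ (w ℕ.* w) + ℕtoℚ (n ℕ.* irregularWeight G d ε F ψ)
          ≡⟨ cong₂ (λ p q → ρ * N * p + q) (ℕtoℚ-homo-* w w) (ℕtoℚ-homo-* n (irregularWeight G d ε F ψ)) ⟩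
        ρ * N * (x * x) + N * ℕtoℚ (irregularWeight G d ε F ψ)
          ≤⟨ +-monoʳ-≤ (ρ * N * (x * x)) (*-monoˡ-≤-nonNeg′ (0≤ℕtoℚ n) irregular) ⟩
        ρ * N * (x * x) + N * (ε * N * N)
          ≡⟨ regroup ρ N x ε ⟩
        N * (ρ * x * x + ε * N * N) ∎
        where
        open ≤-Reasoning
        c = ℓ F ↾ S
        w = weight (ℓ F) S
        x = ℕtoℚ w
        regroup : ∀ ρ N x ε → ρ * N * (x * x) + N * (ε * N * N) ≡ N * (ρ * x * x + ε * N * N)
        regroup = solve 4 (λ ρ N x ε → ρ :* N :* (x :* x) :+ N :* (ε :* N :* N)
                                       := N :* (ρ :* x :* x :+ ε :* N :* N)) refl

    module Violation (S : Fin K → Bool) (violated : ∣N∣ H S ℕ.< weight (ℓ F) S) where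

      private
        c = ℓ F ↾ S
        w = weight (ℓ F) S
        a = load H c
        W = support n a
        x = ℕtoℚ w

        W<w : W ℕ.< w
        W<w = ℕ.≤-<-trans (support≤∣N∣ H (ℓ F) S) violated

        -- weightAt G F ψ v is definitionally load H (ℓ F) v.
        x+load≤N : ∀ v → a v ≡ 0 → x + ℕtoℚ (weightAt G F ψ v) ≤ N
        x+load≤N v a≡0 = subst (_≤ N) (ℕtoℚ-homo-+ w (weightAt G F ψ v))
                           (ℕtoℚ-mono-≤ (ℕ.≤-trans (load≡0⇒disjoint H (ℓ F) S v a≡0) leaves≤n))

      bad-zero-loads-impossible : (∀ v → a v ≡ 0 → ¬ Good v) → ⊥
      bad-zero-loads-impossible bad = ℕ.<⇒≱ W<w (ℕ.+-cancelʳ-≤ Z w W (ℕ.≤-trans w+Z≤n (ℕ.≤-reflexive n≡W+Z)))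
        where
        Z = countFin n (λ v → not (0 <ᵇ a v))
        n≡W+Z : n ≡ W ℕ.+ Z
        n≡W+Z = trans (sym (countFin-not+countFin n (λ v → 0 <ᵇ a v))) (ℕ.+-comm Z W)
        Z≤bad : Z ℕ.≤ badCount G d ε F ψ
        Z≤bad = countFin-mono n _ _ λ v zero-load →
          cong not (trans (isYes≗does (good? v)) (dec-false (good? v) (bad v (¬0<ᵇ⇒≡0 zero-load))))
        via-zero-load : ∃ (λ v → not (0 <ᵇ a v) ≡ true) → w ℕ.+ Z ℕ.≤ n
        via-zero-load (v , zero-load) = ℕtoℚ-cancel-≤ (begin
          ℕtoℚ (w ℕ.+ Z)                ≡⟨ ℕtoℚ-homo-+ w Z ⟩
          x + ℕtoℚ Z                    ≤⟨ +-monoʳ-≤ x (≤-trans (ℕtoℚ-mono-≤ Z≤bad) few-bad) ⟩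
          x + ν * N                     ≤⟨ +-monoʳ-≤ x (loads v) ⟩
          x + ℕtoℚ (weightAt G F ψ v)   ≤⟨ x+load≤N v (¬0<ᵇ⇒≡0 zero-load) ⟩
          N                             ∎)
          where open ≤-Reasoning
        w+Z≤n : w ℕ.+ Z ℕ.≤ n
        w+Z≤n = [ (λ 0<Z → via-zero-load (countFin-positive n (λ v → not (0 <ᵇ a v)) 0<Z))
                , (λ 0≡Z → subst (λ z → w ℕ.+ z ℕ.≤ n) 0≡Z
                     (ℕ.≤-trans (ℕ.≤-reflexive (ℕ.+-identityʳ w))
                                (ℕ.≤-trans (sumFin-mono-≤ K (↾≤ (ℓ F) S)) leaves≤n)))
                ]′ (ℕ.m≤n⇒m<n∨m≡n (ℕ.z≤n {Z}))

      good-zero-load-impossible : ∀ v → a v ≡ 0 → Good v → ⊥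
      good-zero-load-impossible v a≡0 good = <-irrefl refl (<-≤-trans (density-violated 0<d d<1 0<ε ε≤ε₀)
        (density-inequality 0≤d-ε 0≤ρ (<⇒≤ 0<ε) (0≤ℕtoℚ n) 0<x δN≤x x+δN≤N δN²x≤Q (second-moment≤ S)))
        where
        y = ℕtoℚ W
        A = ℕtoℚ (sumFin n a)
        a² = λ v → a v ℕ.* a v
        Q = ℕtoℚ (sumFin n a²)
        0≤d-ε = 0≤δ 0<d d<1 0<ε ε≤ε₀
        0<x : 0ℚ < x
        0<x = ℕtoℚ-mono-< (ℕ.≤-<-trans ℕ.z≤n W<w)
        y≤x : y ≤ x
        y≤x = ℕtoℚ-mono-≤ (ℕ.<⇒≤ W<w)
        δN≤y : δ * N ≤ y
        δN≤y = via-centre (sumFin-positive K c (ℕ.≤-<-trans ℕ.z≤n W<w))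
          where
          via-centre : ∃ (λ i → 0 ℕ.< c i) → δ * N ≤ y
          via-centre (i , 0<ci) = ≤-trans (δN≤ (proj₁ (degrees (ψ i)))) (ℕtoℚ-mono-≤ (degU≤support H c i 0<ci))
        δN≤x : δ * N ≤ x
        δN≤x = ≤-trans δN≤y y≤x
        x+δN≤N : x + δ * N ≤ N
        x+δN≤N = ≤-trans (+-monoʳ-≤ x (δN≤ (proj₁ good))) (x+load≤N v a≡0)
        A²≤yQ : A * A ≤ y * Q
        A²≤yQ = subst₂ _≤_ (ℕtoℚ-homo-* (sumFin n a) (sumFin n a)) (ℕtoℚ-homo-* W (sumFin n a²))
                  (ℕtoℚ-mono-≤ {sumFin n a ℕ.* sumFin n a} {W ℕ.* sumFin n a²} (cauchy-schwarz n a))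
        δN²x≤Q : δ * N * (δ * N) * x ≤ Q
        δN²x≤Q = mean²≤second-moment (*-nonNeg 0≤d-ε (0≤ℕtoℚ n)) 0<x y≤x (0≤ℕtoℚ (sumFin n a²))
                                     (first-moment≥ S) A²≤yQ

    hall-condition : HallCondition H (ℓ F)
    hall-condition S = decidable-stable (weight (ℓ F) S ℕ.≤? ∣N∣ H S) λ fails →
      [ (λ (v , a≡0 , good) → Violation.good-zero-load-impossible S (ℕ.≰⇒> fails) v a≡0 good)
      , (λ none → Violation.bad-zero-loads-impossible S (ℕ.≰⇒> fails) λ v a≡0 good → none (v , a≡0 , good))
      ]′ (toSum (any? (λ v → (load H (ℓ F ↾ S) v ℕ.≟ 0) ×-dec good? v)))

open import Defs
open import Data.Nat using (ℕ; _≥_) renaming (_≤_ to _≤ℕ_)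
open import Data.Fin using (Fin)
open import Data.Product using (Σ; Σ-syntax; _×_; _,_)
open import Data.Rational using (ℚ; 0ℚ; 1ℚ; _<_; _≤_; _*_)
open import Function.Definitions using (Injective)
open import Relation.Binary.PropositionalEquality using (_≡_)

open import Data.Fin.Base using (toℕ)
open import Data.Fin.Properties using (toℕ<n; toℕ-injective)
open import Data.Sum.Base using (inj₁; inj₂)
open import Data.Sum.Properties using (inj₁-injective; inj₂-injective)
open import Relation.Binary.PropositionalEquality using (refl; cong)
open HallTheorem using (Matching; hall)
open Parameters using (ε₀; 0<ε₀)
open Regularity using (hall-condition)

matching⇒embedding : ∀ {m n} (G : BipGraph m n) (F : StarForest) (ψ : Cen F → Fin m) → Injective _≡_ _≡_ ψ →
            Matching (λ i v → G (ψ i) v) (ℓ F) → Σ[ φ ∈ (VF F → VG m n) ] IsEmbeddingExtending G F ψ φ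
matching⇒embedding {m} {n} G F ψ ψ-injective M = φ , injective , edges , λ _ → refl
  where
  open Matching M
  φ : VF F → VG m n
  φ (inj₁ i)       = inj₁ (ψ i)
  φ (inj₂ (i , j)) = inj₂ (partner i (toℕ j) (toℕ<n j))
  injective : Injective _≡_ _≡_ φ
  injective {inj₁ i}       {inj₁ i'}        same = cong inj₁ (ψ-injective (inj₁-injective same))
  injective {inj₂ (i , j)} {inj₂ (i' , j')} same
    with partner-injective (toℕ<n j) (toℕ<n j') (inj₂-injective same)
  ... | refl , toℕj≡toℕj' = cong (λ j → inj₂ (i , j)) (toℕ-injective toℕj≡toℕj')
  edges : ∀ x y → EdgeF F x y → EdgeG G (φ x) (φ y)
  edges (inj₁ i)       (inj₂ (.i , j)) refl = partner-adjacent i (toℕ j) (toℕ<n j)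
  edges (inj₂ (i , j)) (inj₁ .i)       refl = partner-adjacent i (toℕ j) (toℕ<n j)

lemma4p6 :
    (d : ℚ) → 0ℚ < d → d < 1ℚ →
    Σ[ ε₀ ∈ ℚ ] (0ℚ < ε₀ ×
      ((ε : ℚ) → 0ℚ < ε → ε ≤ ε₀ →
        Σ[ n₀ ∈ ℕ ] ((n : ℕ) → n ≥ n₀ →
          (ν : ℚ) → 0ℚ ≤ ν → ν < ε →
          (m : ℕ) (G : BipGraph m n) (F : StarForest) (ψ : Cen F → Fin m) →
          numLeaves F ≤ℕ n →
          Injective _≡_ _≡_ ψ →
          ((u : Fin m) → ℕtoℚ (degU G u) ≈ d * ℕtoℚ n ± ε * ℕtoℚ n) →
          ((v : Fin n) → ν * ℕtoℚ n ≤ ℕtoℚ (weightAt G F ψ v)) →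
          ℕtoℚ (badCount G d ε F ψ) ≤ ν * ℕtoℚ n →
          ℕtoℚ (irregularWeight G d ε F ψ) ≤ ε * ℕtoℚ n * ℕtoℚ n →
          Σ[ φ ∈ (VF F → VG m n) ] IsEmbeddingExtending G F ψ φ)))
lemma4p6 d 0<d d<1 = ε₀ d , 0<ε₀ 0<d , λ ε 0<ε ε≤ε₀ → 0 ,
  λ n _ ν _ _ m G F ψ leaves≤n ψ-injective degrees loads few-bad irregular →
    matching⇒embedding G F ψ ψ-injective (hall _ (ℓ F)
      (hall-condition G F ψ d ε ν 0<d d<1 0<ε ε≤ε₀ leaves≤n degrees loads few-bad irregular))
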